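{- Let $\sigma\in S_n(132)$ and $T(\sigma)=\{i\in[n]:\ \sigma^{ -1}(i)>i\text{ and }\sigma(i)>i\}$. Then: (a) $T(\sigma)=\emptyset$ if and only if $\sigma(1)=1$; (b) if $j\in T(\sigma)$ then $i\in T(\sigma)$ for all $1\le i\le j$; (c) $|T(\sigma)|\le n/2$; (d) if $D=\Phi(\sigma)$ then $|T(\sigma)|=|D^{(R)}|_u$; (e) if $k=1+|T(\sigma)|$, then $\sigma^{(k,k)}\in S_{n+1}(132)$.
   Context: $S_n(132)$ is the set of permutations of $[n]$ avoiding the pattern $132$. For $\sigma\in S_n$ and $1\le a,b\le n+1$, $\sigma^{(a,b)}\in S_{n+1}$ is obtained by adding $1$ to every entry of $\sigma$ that is $\ge b$ and then inserting the value $b$ at position $a$. A Dyck path of semilength $n$ is a path from $(0,0)$ to $(2n,0)$ with steps $u=(1,1)$, $d=(1,-1)$ never below the $x$-axis; $D^{(R)}$ is its last $n$ steps and $|w|_u$ the number of up-steps of $w$. Each up-step is matched with the first later down-step ending at the height where the up-step starts. Labelling up-steps left to right $n,\dots,1$ and down-steps left to right $1,\dots,n$, $\Phi^{ -1}(D)$ is the permutation sending the label of each up-step to the label of its matched down-step; $\Phi^{ -1}$ is a bijection from Dyck paths of semilength $n$ to $S_n(132)$, and $\Phi$ is its inverse. -}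

module Defs where

open import Data.Nat using (ℕ; zero; suc; _+_; _*_; _∸_)
open import Data.Fin using (Fin; toℕ; _<_)
open import Data.Fin.Permutation using (Permutation′; _⟨$⟩ʳ_; _⟨$⟩ˡ_)
open import Data.List using (List; []; _∷_; length; filter; allFin; drop)
open import Data.Product using (_×_; _,_)
open import Data.Maybe using (Maybe; just; nothing)
open import Data.Nat using (_≟_)
open import Relation.Nullary using (¬_; Dec; yes; no)
open import Relation.Nullary.Decidable using (_×-dec_)
open import Data.Fin.Properties using (_<?_)
open import Relation.Binary.PropositionalEquality using (_≡_)

-- Conventions: [n] is represented by Fin n, with 1-based value i ↔ 0-based toℕ i = i - 1.
-- A permutation σ ∈ S_n is an element of Permutation′ n (a bijection Fin n ↔ Fin n);
-- σ ⟨$⟩ʳ i is σ(i) and σ ⟨$⟩ˡ i is σ⁻¹(i).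

Avoids132 : ∀ {n} → Permutation′ n → Set
Avoids132 {n} σ = ∀ (i j k : Fin n) → i < j → j < k →
  ¬ ((σ ⟨$⟩ʳ i) < (σ ⟨$⟩ʳ k) × (σ ⟨$⟩ʳ k) < (σ ⟨$⟩ʳ j))

-- i ∈ T(σ)  iff  σ⁻¹(i) > i and σ(i) > i   (shift by 1 does not change comparisons)
InT : ∀ {n} → Permutation′ n → Fin n → Set
InT σ i = (i < (σ ⟨$⟩ˡ i)) × (i < (σ ⟨$⟩ʳ i))

InT? : ∀ {n} (σ : Permutation′ n) (i : Fin n) → Dec (InT σ i)
InT? σ i = (i <? (σ ⟨$⟩ˡ i)) ×-dec (i <? (σ ⟨$⟩ʳ i))

cardT : ∀ {n} → Permutation′ n → ℕ
cardT {n} σ = length (filter (InT? σ) (allFin n))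

data Step : Set where
  u d : Step

data ValidFrom : ℕ → List Step → Set where
  done : ValidFrom zero []
  up   : ∀ {h w} → ValidFrom (suc h) w → ValidFrom h (u ∷ w)
  down : ∀ {h w} → ValidFrom h w → ValidFrom (suc h) (d ∷ w)

IsDyck : ℕ → List Step → Set
IsDyck n w = ValidFrom zero w × length w ≡ (2 * n)

countU : List Step → ℕ
countU [] = zero
countU (u ∷ w) = suc (countU w)
countU (d ∷ w) = countU w

rightHalf : ℕ → List Step → List Step
rightHalf n w = drop n w

-- Matching of up-steps with down-steps (stack matching: each up-step is
-- matched with the first later down-step ending at the height where the
-- up-step starts).  Produces pairs (index of up-step among up-steps,
-- index of down-step among down-steps), both 0-based, left to right.
matchGo : ℕ → ℕ → List ℕ → List Step → List (ℕ × ℕ)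
matchGo U D st [] = []
matchGo U D st (u ∷ w) = matchGo (suc U) D (U ∷ st) w
matchGo U D [] (d ∷ w) = matchGo U (suc D) [] w
matchGo U D (x ∷ st) (d ∷ w) = (x , D) ∷ matchGo U (suc D) st w

matching : List Step → List (ℕ × ℕ)
matching w = matchGo zero zero [] w

lookupPair : ℕ → List (ℕ × ℕ) → Maybe ℕ
lookupPair x [] = nothing
lookupPair x ((a , b) ∷ ps) with x ≟ a
... | yes _ = just b
... | no  _ = lookupPair x ps

-- Up-steps are labelled left to right
-- n,…,1 (1-based), i.e. the up-step with 0-based index k has 0-based label
-- n-1-k; the down-step with 0-based index m has 0-based label m.
PhiInv : ℕ → List Step → ℕ → Maybe ℕ
PhiInv n w l = lookupPair (n ∸ suc l) (matching w)

-- D = Φ(σ)  iff  D is a Dyck path of semilength n with Φ⁻¹(D) = σ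
-- (Φ is the inverse of the bijection Φ⁻¹).
IsPhiOf : ∀ {n} → Permutation′ n → List Step → Set
IsPhiOf {n} σ w = IsDyck n w ×
  (∀ (i : Fin n) → PhiInv n w (toℕ i) ≡ just (toℕ (σ ⟨$⟩ʳ i)))

-- Write t = |T(σ)|.  The heart of the proof is one 132-argument: if j ∈ T and i ≤ j then
-- σ(i) > j and σ⁻¹(i) > j.  This gives (b), and since T is therefore downward closed it is the
-- initial segment {0,…,t-1}; moreover every q < t satisfies σ(q) ≥ t and σ⁻¹(q) ≥ t.
--   (a) If σ(0) ≠ 0 then 0 ∈ T; if σ(0) = 0 then 0 ∉ T, hence T = ∅ by (b).
--   (c) q ↦ σ(q) - t injects {0,…,t-1} into {0,…,n-t-1}.
--   (d) Let X, Y be the two halves of D and c the number of down-steps of X, so that Y has c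
--       up-steps.  Matched pairs lying inside X show {0,…,c-1} ⊆ T; the first down-step of Y is
--       matched with the latest still-open up-step, which is at least as late as the up-step of
--       t-1 ∈ T, and this forces t ≤ c.
--   (e) σ^{(t,t)} places values larger than t before the new fixed point t; a 132 pattern in it
--       would yield either a 132 in σ or an inversion of σ beyond t whose smaller value is ≥ t,
--       and the latter is excluded because t ∉ T.
module Submission where

open import Defs
open import Data.Nat using (ℕ; suc; _*_; _≤_) renaming (_<_ to _<ℕ_)
open import Data.Fin using (Fin; toℕ; fromℕ<; _<_) renaming (_≤_ to _≤ᶠ_)
open import Data.Fin.Permutation using (Permutation′; _⟨$⟩ʳ_; insert)
open import Data.List using (List)
open import Data.Product using (_×_)
open import Function.Bundles using (_⇔_)
open import Relation.Binary.PropositionalEquality using (_≡_)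
open import Relation.Nullary using (¬_)

open import Data.Nat using (zero; _+_; _∸_; pred; z≤n; s≤s; s≤s⁻¹; s<s⁻¹; _<?_; _≤?_; >-nonZero)
  renaming (_≟_ to _≟ℕ_)
open import Data.Nat.Properties
open import Data.Fin using (zero; suc; punchIn; punchOut)
open import Data.Fin.Properties
  using (toℕ-injective; toℕ<n; toℕ-fromℕ<; injective⇒≤; punchIn-mono-≤; punchIn-punchOut)
  renaming (_≟_ to _≟ᶠ_)
open import Data.Fin.Permutation using (_⟨$⟩ˡ_; inverseˡ; inverseʳ; insert-punchIn)
open import Data.List using ([]; _∷_; length; filter; tabulate; allFin; drop; take; _++_; replicate)
open import Data.List.Properties using (length-filter; length-tabulate; take++drop≡id; length-take; ++-assoc)
open import Data.List.Membership.Propositional using (_∈_)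
open import Data.List.Membership.Propositional.Properties using (∈-++⁻; ∈-++⁺ʳ)
open import Data.List.Relation.Unary.Any using (here; there)
open import Data.List.Relation.Unary.All as All using (All; []; _∷_)
open import Data.Product using (Σ; _,_; proj₁; proj₂)
open import Data.Sum using (_⊎_; inj₁; inj₂)
open import Data.Empty using (⊥; ⊥-elim)
open import Data.Unit using (⊤; tt)
open import Data.Maybe using (just)
open import Data.Maybe.Properties using (just-injective)
open import Relation.Nullary using (Dec; yes; no)
open import Relation.Unary using (Decidable)
open import Relation.Binary.PropositionalEquality using (refl; sym; trans; cong; subst; subst₂; _≢_; module ≡-Reasoning)
open import Function using (_∘_; id)
open import Function.Bundles using (mk⇔)

-- Filtering an enumeration by a predicate that is downward closed along it keeps exactly an
-- initial segment; this identifies T(σ) with {0,…,t-1}.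
module _ {A : Set} {P : A → Set} (P? : Decidable P) where

  filter-none : ∀ {m} (f : Fin m → A) → (∀ i → ¬ P (f i)) → length (filter P? (tabulate f)) ≡ 0
  filter-none {zero} f none = refl
  filter-none {suc m} f none with P? (f zero)
  ... | yes p = ⊥-elim (none zero p)
  ... | no _ = filter-none (f ∘ suc) (none ∘ suc)

  filter-initial : ∀ {m} (f : Fin m → A) → (∀ i j → toℕ i ≤ toℕ j → P (f j) → P (f i)) →
    ∀ i → (P (f i) → toℕ i <ℕ length (filter P? (tabulate f)))
        × (toℕ i <ℕ length (filter P? (tabulate f)) → P (f i))
  filter-initial {suc m} f closed i with P? (f zero)
  filter-initial {suc m} f closed zero | yes p = (λ _ → s≤s z≤n) , (λ _ → p)
  filter-initial {suc m} f closed (suc i) | yes p =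
    let ih = filter-initial (f ∘ suc) (λ a b le → closed (suc a) (suc b) (s≤s le)) i
    in (λ q → s≤s (proj₁ ih q)) , (λ lt → proj₂ ih (s≤s⁻¹ lt))
  ... | no ¬p rewrite filter-none (f ∘ suc) (λ k q → ¬p (closed zero (suc k) z≤n q)) =
    (λ q → ⊥-elim (¬p (closed zero i z≤n q))) , (λ ())

-- punchIn k shifts the entries ≥ k up by one; these facts describe σ^{(k,k)} = insert k k σ.
module _ {m : ℕ} (k : Fin (suc m)) where

  toℕ-punchIn-below : ∀ q → toℕ q <ℕ toℕ k → toℕ (punchIn k q) ≡ toℕ q
  toℕ-punchIn-below = go k
    where
    go : ∀ {m} (k : Fin (suc m)) q → toℕ q <ℕ toℕ k → toℕ (punchIn k q) ≡ toℕ q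
    go (suc k) zero lt = refl
    go (suc k) (suc q) lt = cong suc (go k q (s<s⁻¹ lt))

  toℕ-punchIn-above : ∀ q → toℕ k ≤ toℕ q → toℕ (punchIn k q) ≡ suc (toℕ q)
  toℕ-punchIn-above = go k
    where
    go : ∀ {m} (k : Fin (suc m)) q → toℕ k ≤ toℕ q → toℕ (punchIn k q) ≡ suc (toℕ q)
    go zero q le = refl
    go (suc k) (suc q) le = cong suc (go k q (s≤s⁻¹ le))

  punchIn-above⇒ : ∀ q → toℕ k <ℕ toℕ (punchIn k q) → toℕ k ≤ toℕ q
  punchIn-above⇒ q above with toℕ q <? toℕ k
  ... | yes q<k = ⊥-elim (<-asym q<k (subst (toℕ k <ℕ_) (toℕ-punchIn-below q q<k) above))
  ... | no q≮k = ≮⇒≥ q≮k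

  punchIn-below⇒ : ∀ q → toℕ (punchIn k q) <ℕ toℕ k → toℕ q <ℕ toℕ k
  punchIn-below⇒ q below = ≤-<-trans (punchIn-≥ q) below
    where
    punchIn-≥ : ∀ q → toℕ q ≤ toℕ (punchIn k q)
    punchIn-≥ q with toℕ q <? toℕ k
    ... | yes q<k = ≤-reflexive (sym (toℕ-punchIn-below q q<k))
    ... | no q≮k = subst (toℕ q ≤_) (sym (toℕ-punchIn-above q (≮⇒≥ q≮k))) (n≤1+n _)

  above⇒punchIn-above : ∀ q → toℕ k ≤ toℕ q → toℕ k <ℕ toℕ (punchIn k q)
  above⇒punchIn-above q le = subst (toℕ k <ℕ_) (sym (toℕ-punchIn-above q le)) (s≤s le)

  punchIn-cancel-< : ∀ a b → toℕ (punchIn k a) <ℕ toℕ (punchIn k b) → toℕ a <ℕ toℕ b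
  punchIn-cancel-< a b lt with toℕ a <? toℕ b
  ... | yes a<b = a<b
  ... | no a≮b = ⊥-elim (<-irrefl refl (<-≤-trans lt (punchIn-mono-≤ k b a (≮⇒≥ a≮b))))

  punchIn-view : ∀ p → (p ≡ k) ⊎ Σ (Fin m) (λ q → p ≡ punchIn k q)
  punchIn-view p with k ≟ᶠ p
  ... | yes k≡p = inj₁ (sym k≡p)
  ... | no k≢p = inj₂ (punchOut k≢p , sym (punchIn-punchOut k≢p))

  insert-self : (π : Permutation′ m) → insert k k π ⟨$⟩ʳ k ≡ k
  insert-self π with k ≟ᶠ k
  ... | yes _ = refl
  ... | no k≢k = ⊥-elim (k≢k refl)

countD : List Step → ℕ
countD [] = zero
countD (u ∷ w) = countD w
countD (d ∷ w) = suc (countD w)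

countU-++ : ∀ X Y → countU (X ++ Y) ≡ countU X + countU Y
countU-++ [] Y = refl
countU-++ (u ∷ X) Y = cong suc (countU-++ X Y)
countU-++ (d ∷ X) Y = countU-++ X Y

countD-++ : ∀ X Y → countD (X ++ Y) ≡ countD X + countD Y
countD-++ [] Y = refl
countD-++ (u ∷ X) Y = countD-++ X Y
countD-++ (d ∷ X) Y = cong suc (countD-++ X Y)

length-counts : ∀ w → length w ≡ countU w + countD w
length-counts [] = refl
length-counts (u ∷ w) = cong suc (length-counts w)
length-counts (d ∷ w) = trans (cong suc (length-counts w)) (sym (+-suc (countU w) (countD w)))

valid-counts : ∀ {h w} → ValidFrom h w → countD w ≡ h + countU w
valid-counts done = refl
valid-counts {h} (up {w = w} v) = trans (valid-counts v) (sym (+-suc h (countU w)))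
valid-counts (down v) = cong suc (valid-counts v)

first-down : ∀ Y → 0 <ℕ countD Y → Σ ℕ λ r → Σ (List Step) λ R → Y ≡ replicate r u ++ (d ∷ R)
first-down (d ∷ Y) _ = 0 , Y , refl
first-down (u ∷ Y) h with first-down Y h
... | r , R , e = suc r , R , cong (u ∷_) e

-- The state of matchGo after reading a word: the up- and down-step counters and the stack of
-- open up-steps.  Matching a concatenation factors through this state.
endU : ℕ → List Step → ℕ
endU U [] = U
endU U (u ∷ w) = endU (suc U) w
endU U (d ∷ w) = endU U w

endD : ℕ → List Step → ℕ
endD D [] = D
endD D (u ∷ w) = endD D w
endD D (d ∷ w) = endD (suc D) w

stackAfter : ℕ → List ℕ → List Step → List ℕ
stackAfter U st [] = st
stackAfter U st (u ∷ w) = stackAfter (suc U) (U ∷ st) w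
stackAfter U [] (d ∷ w) = stackAfter U [] w
stackAfter U (x ∷ st) (d ∷ w) = stackAfter U st w

endU-count : ∀ U X → endU U X ≡ U + countU X
endU-count U [] = sym (+-identityʳ U)
endU-count U (u ∷ X) = trans (endU-count (suc U) X) (sym (+-suc U _))
endU-count U (d ∷ X) = endU-count U X

endD-count : ∀ D X → endD D X ≡ D + countD X
endD-count D [] = sym (+-identityʳ D)
endD-count D (u ∷ X) = endD-count D X
endD-count D (d ∷ X) = trans (endD-count (suc D) X) (sym (+-suc D _))

matchGo-++ : ∀ U D st X Y →
  matchGo U D st (X ++ Y) ≡ matchGo U D st X ++ matchGo (endU U X) (endD D X) (stackAfter U st X) Y
matchGo-++ U D st [] Y = refl
matchGo-++ U D st (u ∷ X) Y = matchGo-++ (suc U) D (U ∷ st) X Y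
matchGo-++ U D [] (d ∷ X) Y = matchGo-++ U (suc D) [] X Y
matchGo-++ U D (x ∷ st) (d ∷ X) Y = cong ((x , D) ∷_) (matchGo-++ U (suc D) st X Y)

stackAfter-++ : ∀ U st X Y → stackAfter U st (X ++ Y) ≡ stackAfter (endU U X) (stackAfter U st X) Y
stackAfter-++ U st [] Y = refl
stackAfter-++ U st (u ∷ X) Y = stackAfter-++ (suc U) (U ∷ st) X Y
stackAfter-++ U [] (d ∷ X) Y = stackAfter-++ U [] X Y
stackAfter-++ U (x ∷ st) (d ∷ X) Y = stackAfter-++ U st X Y

stackAfter-ups : ∀ U st r {x} → x ∈ st → x ∈ stackAfter U st (replicate r u)
stackAfter-ups U st zero x∈st = x∈st
stackAfter-ups U st (suc r) x∈st = stackAfter-ups (suc U) (U ∷ st) r (there x∈st)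

matchGo-downRange : ∀ U D st w {x m} → (x , m) ∈ matchGo U D st w → D ≤ m × m <ℕ endD D w
matchGo-downRange U D st (u ∷ w) mem = matchGo-downRange (suc U) D (U ∷ st) w mem
matchGo-downRange U D [] (d ∷ w) mem =
  let r = matchGo-downRange U (suc D) [] w mem in <⇒≤ (proj₁ r) , proj₂ r
matchGo-downRange U D (x ∷ st) (d ∷ w) (here refl) =
  ≤-refl , subst (D <ℕ_) (sym (endD-count (suc D) w)) (m≤m+n (suc D) _)
matchGo-downRange U D (x ∷ st) (d ∷ w) (there mem) =
  let r = matchGo-downRange U (suc D) st w mem in <⇒≤ (proj₁ r) , proj₂ r

matchGo-upOrigin : ∀ U D st w {x m} → (x , m) ∈ matchGo U D st w → x ∈ st ⊎ (U ≤ x × x <ℕ endU U w)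
matchGo-upOrigin U D st (u ∷ w) mem with matchGo-upOrigin (suc U) D (U ∷ st) w mem
... | inj₁ (here refl) = inj₂ (≤-refl , subst (U <ℕ_) (sym (endU-count (suc U) w)) (m≤m+n (suc U) _))
... | inj₁ (there x∈st) = inj₁ x∈st
... | inj₂ (U<x , x<end) = inj₂ (<⇒≤ U<x , x<end)
matchGo-upOrigin U D [] (d ∷ w) mem = matchGo-upOrigin U (suc D) [] w mem
matchGo-upOrigin U D (x ∷ st) (d ∷ w) (here refl) = inj₁ (here refl)
matchGo-upOrigin U D (x ∷ st) (d ∷ w) (there mem) with matchGo-upOrigin U (suc D) st w mem
... | inj₁ x∈st = inj₁ (there x∈st)
... | inj₂ range = inj₂ range

matchGo-downUnique : ∀ U D st w {x y m} → (x , m) ∈ matchGo U D st w → (y , m) ∈ matchGo U D st w → x ≡ y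
matchGo-downUnique U D st (u ∷ w) p q = matchGo-downUnique (suc U) D (U ∷ st) w p q
matchGo-downUnique U D [] (d ∷ w) p q = matchGo-downUnique U (suc D) [] w p q
matchGo-downUnique U D (x ∷ st) (d ∷ w) (here refl) (here refl) = refl
matchGo-downUnique U D (x ∷ st) (d ∷ w) (here refl) (there q) =
  ⊥-elim (<-irrefl refl (proj₁ (matchGo-downRange U (suc D) st w q)))
matchGo-downUnique U D (x ∷ st) (d ∷ w) (there p) (here refl) =
  ⊥-elim (<-irrefl refl (proj₁ (matchGo-downRange U (suc D) st w p)))
matchGo-downUnique U D (x ∷ st) (d ∷ w) (there p) (there q) = matchGo-downUnique U (suc D) st w p q

-- The stack is strictly decreasing: its top is the latest open up-step.
Descending : List ℕ → Set
Descending [] = ⊤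
Descending (x ∷ xs) = All (_<ℕ x) xs × Descending xs

stackAfter-descending : ∀ U st w → All (_<ℕ U) st → Descending st →
  All (_<ℕ endU U w) (stackAfter U st w) × Descending (stackAfter U st w)
stackAfter-descending U st [] bound desc = bound , desc
stackAfter-descending U st (u ∷ w) bound desc =
  stackAfter-descending (suc U) (U ∷ st) w (n<1+n U ∷ All.map m<n⇒m<1+n bound) (bound , desc)
stackAfter-descending U [] (d ∷ w) bound desc = stackAfter-descending U [] w bound desc
stackAfter-descending U (x ∷ st) (d ∷ w) (_ ∷ bound) (_ , desc) = stackAfter-descending U st w bound desc

matchGo-top : ∀ U D st R x → x ∈ st → Descending st → Σ ℕ λ y → x ≤ y × (y , D) ∈ matchGo U D st (d ∷ R)
matchGo-top U D (y ∷ st) R x (here refl) desc = y , ≤-refl , here refl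
matchGo-top U D (y ∷ st) R x (there x∈st) (below , _) = y , <⇒≤ (All.lookup below x∈st) , here refl

matching-side : ∀ X Y {x m} → (x , m) ∈ matching (X ++ Y) →
  (x <ℕ countU X × m <ℕ countD X) ⊎ (countD X ≤ m × (x ∈ stackAfter 0 [] X ⊎ countU X ≤ x))
matching-side X Y {x} {m} mem with ∈-++⁻ (matchGo 0 0 [] X) (subst ((x , m) ∈_) (matchGo-++ 0 0 [] X Y) mem)
... | inj₁ inX with matchGo-upOrigin 0 0 [] X inX
...   | inj₂ (_ , x<) = inj₁ (subst (x <ℕ_) (endU-count 0 X) x< ,
                               subst (m <ℕ_) (endD-count 0 X) (proj₂ (matchGo-downRange 0 0 [] X inX)))
matching-side X Y {x} {m} mem | inj₂ inY =
  inj₂ (down-in-Y , up-origin (matchGo-upOrigin (endU 0 X) (endD 0 X) (stackAfter 0 [] X) Y inY))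
  where
  down-in-Y : countD X ≤ m
  down-in-Y = subst (_≤ m) (endD-count 0 X) (proj₁ (matchGo-downRange _ _ _ Y inY))
  up-origin : x ∈ stackAfter 0 [] X ⊎ (endU 0 X ≤ x × x <ℕ endU (endU 0 X) Y) →
              x ∈ stackAfter 0 [] X ⊎ countU X ≤ x
  up-origin (inj₁ isOpen) = inj₁ isOpen
  up-origin (inj₂ (le , _)) = inj₂ (subst (_≤ x) (endU-count 0 X) le)

first-down-matched-later : ∀ X Y x → x ∈ stackAfter 0 [] X → 0 <ℕ countD Y →
  Σ ℕ λ y → x ≤ y × (y , countD X) ∈ matching (X ++ Y)
first-down-matched-later X Y x isOpen hasDown with first-down Y hasDown
... | r , R , refl = y , x≤y , subst ((y , countD X) ∈_) (sym matching-eq)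
                                  (∈-++⁺ʳ (matchGo 0 0 [] Z) top)
  where
  Z : List Step
  Z = X ++ replicate r u
  stack-Z : stackAfter 0 [] Z ≡ stackAfter (endU 0 X) (stackAfter 0 [] X) (replicate r u)
  stack-Z = stackAfter-++ 0 [] X (replicate r u)
  open-Z : x ∈ stackAfter 0 [] Z
  open-Z = subst (x ∈_) (sym stack-Z) (stackAfter-ups _ _ r isOpen)
  endD-Z : endD 0 Z ≡ countD X
  endD-Z = trans (endD-count 0 Z) (trans (countD-++ X (replicate r u))
             (trans (cong (countD X +_) (ups-no-down r)) (+-identityʳ _)))
    where
    ups-no-down : ∀ r → countD (replicate r u) ≡ 0
    ups-no-down zero = refl
    ups-no-down (suc r) = ups-no-down r
  result : Σ ℕ λ y → x ≤ y × (y , endD 0 Z) ∈ matchGo (endU 0 Z) (endD 0 Z) (stackAfter 0 [] Z) (d ∷ R)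
  result = matchGo-top (endU 0 Z) (endD 0 Z) (stackAfter 0 [] Z) R x open-Z
             (proj₂ (stackAfter-descending 0 [] Z [] tt))
  y : ℕ
  y = proj₁ result
  x≤y : x ≤ y
  x≤y = proj₁ (proj₂ result)
  top : (y , countD X) ∈ matchGo (endU 0 Z) (endD 0 Z) (stackAfter 0 [] Z) (d ∷ R)
  top = subst (λ D → (y , D) ∈ matchGo (endU 0 Z) (endD 0 Z) (stackAfter 0 [] Z) (d ∷ R)) endD-Z
          (proj₂ (proj₂ result))
  matching-eq : matching (X ++ (replicate r u ++ (d ∷ R)))
              ≡ matchGo 0 0 [] Z ++ matchGo (endU 0 Z) (endD 0 Z) (stackAfter 0 [] Z) (d ∷ R)
  matching-eq = trans (cong (matchGo 0 0 []) (sym (++-assoc X (replicate r u) (d ∷ R)))) (matchGo-++ 0 0 [] Z (d ∷ R))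

lookupPair-∈ : ∀ x ps {b} → lookupPair x ps ≡ just b → (x , b) ∈ ps
lookupPair-∈ x ((a , b') ∷ ps) eq with x ≟ℕ a
... | yes refl = here (cong (x ,_) (sym (just-injective eq)))
... | no _ = there (lookupPair-∈ x ps eq)

-- Up-steps are labelled in reverse: label l sits at up-index x with x + suc l ≡ N.  These
-- lemmas translate comparisons of up-indices into comparisons of labels.
up-index-below : ∀ {x l N a c} → x + suc l ≡ N → a + c ≡ N → x <ℕ a → c ≤ l
up-index-below {x} {l} {N} {a} {c} x+l a+c x<a with l <? c
... | no l≮c = ≮⇒≥ l≮c
... | yes l<c = ⊥-elim (<-irrefl (trans x+l (sym a+c)) (+-mono-<-≤ x<a l<c))

up-index-above : ∀ {x l N a c} → x + suc l ≡ N → a + c ≡ N → c ≤ l → x <ℕ a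
up-index-above {x} {l} {N} {a} {c} x+l a+c c≤l with x <? a
... | yes x<a = x<a
... | no x≮a = ⊥-elim (<-irrefl (trans a+c (sym x+l))
                         (≤-<-trans (+-mono-≤ (≮⇒≥ x≮a) c≤l) (+-monoʳ-< x (n<1+n l))))

up-index-antitone : ∀ {x y l l' N} → x + suc l ≡ N → y + suc l' ≡ N → x ≤ y → l' ≤ l
up-index-antitone {x} {y} {l} {l'} {N} x+l y+l' x≤y with l' ≤? l
... | yes l'≤l = l'≤l
... | no l'≰l = ⊥-elim (<-irrefl (trans x+l (sym y+l'))
                          (≤-<-trans (+-mono-≤ x≤y (≰⇒> l'≰l)) (+-monoʳ-< y (n<1+n l'))))

module Avoiding {n : ℕ} (σ : Permutation′ n) (avoids : Avoids132 σ) where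

  val : Fin n → ℕ
  val i = toℕ (σ ⟨$⟩ʳ i)

  pos : Fin n → ℕ
  pos v = toℕ (σ ⟨$⟩ˡ v)

  val-pos : ∀ v → val (σ ⟨$⟩ˡ v) ≡ toℕ v
  val-pos v = cong toℕ (inverseʳ σ)

  val-injective : ∀ {i j} → val i ≡ val j → i ≡ j
  val-injective e = trans (sym (inverseˡ σ)) (trans (cong (σ ⟨$⟩ˡ_) (toℕ-injective e)) (inverseˡ σ))

  -- Key lemma, value half: if j ∈ T and i < j had σ(i) ≤ j, then i < j < σ⁻¹(j) would carry
  -- the values σ(i) < j < σ(j), a 132.
  T-val-above : ∀ j → InT σ j → ∀ i → toℕ i ≤ toℕ j → toℕ j <ℕ val i
  T-val-above j (j<pos , j<val) i i≤j with m≤n⇒m<n∨m≡n i≤j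
  ... | inj₂ i≡j rewrite toℕ-injective i≡j = j<val
  ... | inj₁ i<j with toℕ j <? val i
  ...   | yes j<vi = j<vi
  ...   | no j≮vi = ⊥-elim (avoids i j p i<j j<pos (vi<vp , vp<vj))
    where
    p : Fin n
    p = σ ⟨$⟩ˡ j
    vi≢j : val i ≢ toℕ j
    vi≢j e = <-irrefl refl (<-trans i<j (subst (λ z → toℕ j <ℕ toℕ z)
                                              (sym (val-injective (trans e (sym (val-pos j))))) j<pos))
    vi<vp : val i <ℕ val p
    vi<vp = subst (val i <ℕ_) (sym (val-pos j)) (≤∧≢⇒< (≮⇒≥ j≮vi) vi≢j)
    vp<vj : val p <ℕ val j
    vp<vj = subst (_<ℕ val j) (sym (val-pos j)) j<val

  -- Key lemma, position half: if j ∈ T and i < j had σ⁻¹(i) ≤ j, then σ⁻¹(i) < j < σ⁻¹(j)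
  -- would carry the values i < j < σ(j), a 132.
  T-pos-above : ∀ j → InT σ j → ∀ i → toℕ i ≤ toℕ j → toℕ j <ℕ pos i
  T-pos-above j (j<pos , j<val) i i≤j with m≤n⇒m<n∨m≡n i≤j
  ... | inj₂ i≡j rewrite toℕ-injective i≡j = j<pos
  ... | inj₁ i<j with toℕ j <? pos i
  ...   | yes j<pi = j<pi
  ...   | no j≮pi = ⊥-elim (avoids (σ ⟨$⟩ˡ i) j p pi<j j<pos (vq<vp , vp<vj))
    where
    p : Fin n
    p = σ ⟨$⟩ˡ j
    pi≢j : pos i ≢ toℕ j
    pi≢j e = <-irrefl refl (<-trans i<j (subst (λ z → toℕ j <ℕ z)
                                              (trans (cong val (sym (toℕ-injective e))) (val-pos i)) j<val))
    pi<j : pos i <ℕ toℕ j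
    pi<j = ≤∧≢⇒< (≮⇒≥ j≮pi) pi≢j
    vq<vp : val (σ ⟨$⟩ˡ i) <ℕ val p
    vq<vp = subst₂ _<ℕ_ (sym (val-pos i)) (sym (val-pos j)) i<j
    vp<vj : val p <ℕ val j
    vp<vj = subst (_<ℕ val j) (sym (val-pos j)) j<val

  T-downClosed : ∀ (j : Fin n) → InT σ j → ∀ (i : Fin n) → i ≤ᶠ j → InT σ i
  T-downClosed j j∈T i i≤j = ≤-<-trans i≤j (T-pos-above j j∈T i i≤j) , ≤-<-trans i≤j (T-val-above j j∈T i i≤j)

  t : ℕ
  t = cardT σ

  T-initial : ∀ i → (InT σ i → toℕ i <ℕ t) × (toℕ i <ℕ t → InT σ i)
  T-initial = filter-initial (InT? σ) id (λ i j i≤j j∈T → T-downClosed j j∈T i i≤j)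

  t≤n : t ≤ n
  t≤n = ≤-trans (length-filter (InT? σ) (allFin n)) (≤-reflexive (length-tabulate id))

  t∉T : (t<n : t <ℕ n) → ¬ InT σ (fromℕ< t<n)
  t∉T t<n t∈T = <-irrefl (toℕ-fromℕ< t<n) (proj₁ (T-initial _) t∈T)

  max-T : 0 <ℕ t → Σ (Fin n) λ j → suc (toℕ j) ≡ t × InT σ j
  max-T 0<t = j , j+1≡t , proj₂ (T-initial j) (≤-reflexive j+1≡t)
    where
    pred-t : suc (pred t) ≡ t
    pred-t = suc-pred t {{>-nonZero 0<t}}
    pred-t<n : pred t <ℕ n
    pred-t<n = <-≤-trans (≤-reflexive pred-t) t≤n
    j : Fin n
    j = fromℕ< pred-t<n
    j+1≡t : suc (toℕ j) ≡ t
    j+1≡t = trans (cong suc (toℕ-fromℕ< pred-t<n)) pred-t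

  below-t : ∀ q → toℕ q <ℕ t → t ≤ val q × t ≤ pos q
  below-t q q<t with max-T (≤-<-trans z≤n q<t)
  ... | j , j+1≡t , j∈T = subst (_≤ val q) j+1≡t (T-val-above j j∈T q q≤j) ,
                          subst (_≤ pos q) j+1≡t (T-pos-above j j∈T q q≤j)
    where
    q≤j : toℕ q ≤ toℕ j
    q≤j = s≤s⁻¹ (subst (suc (toℕ q) ≤_) (sym j+1≡t) q<t)

  -- (a) If σ(0) ≠ 0 then also σ⁻¹(0) ≠ 0, so 0 ∈ T; if σ(0) = 0 then 0 ∉ T
  -- and T is empty by (b).
  T-empty⇔fixes-first : (p : 0 <ℕ n) → ((∀ (i : Fin n) → ¬ InT σ i) ⇔ (σ ⟨$⟩ʳ fromℕ< p ≡ fromℕ< p))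
  T-empty⇔fixes-first p = mk⇔ fixes empty
    where
    first : Fin n
    first = fromℕ< p
    first≡0 : toℕ first ≡ 0
    first≡0 = toℕ-fromℕ< p
    fixes : (∀ i → ¬ InT σ i) → σ ⟨$⟩ʳ first ≡ first
    fixes none with val first ≟ℕ 0
    ... | yes v≡0 = toℕ-injective (trans v≡0 (sym first≡0))
    ... | no v≢0 = ⊥-elim (none first (first<pos , subst (_<ℕ val first) (sym first≡0) (n≢0⇒n>0 v≢0)))
      where
      first<pos : toℕ first <ℕ pos first
      first<pos with pos first ≟ℕ 0
      ... | yes p≡0 = ⊥-elim (v≢0 (trans (cong val (sym (toℕ-injective (trans p≡0 (sym first≡0)))))
                                          (trans (val-pos first) first≡0)))
      ... | no p≢0 = subst (_<ℕ pos first) (sym first≡0) (n≢0⇒n>0 p≢0)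
    empty : σ ⟨$⟩ʳ first ≡ first → ∀ i → ¬ InT σ i
    empty fixed i i∈T = <-irrefl refl (subst (toℕ first <ℕ_) (cong toℕ fixed)
                          (proj₂ (T-downClosed i i∈T first (subst (_≤ toℕ i) (sym first≡0) z≤n))))

  -- (c) q ↦ σ(q) - t injects {0,…,t-1} into {0,…,n-t-1}, so t ≤ n - t
  twice-t≤n : 2 * t ≤ n
  twice-t≤n = subst (_≤ n) (cong (t +_) (sym (+-identityʳ t)))
                (≤-trans (+-monoʳ-≤ t (injective⇒≤ {f = shift} shift-injective)) (≤-reflexive (m+[n∸m]≡n t≤n)))
    where
    embed : Fin t → Fin n
    embed x = fromℕ< (<-≤-trans (toℕ<n x) t≤n)
    toℕ-embed : ∀ x → toℕ (embed x) ≡ toℕ x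
    toℕ-embed x = toℕ-fromℕ< (<-≤-trans (toℕ<n x) t≤n)
    t≤val : ∀ x → t ≤ val (embed x)
    t≤val x = proj₁ (below-t (embed x) (subst (_<ℕ t) (sym (toℕ-embed x)) (toℕ<n x)))
    shift : Fin t → Fin (n ∸ t)
    shift x = fromℕ< (∸-monoˡ-< (toℕ<n (σ ⟨$⟩ʳ embed x)) (t≤val x))
    toℕ-shift : ∀ x → toℕ (shift x) ≡ val (embed x) ∸ t
    toℕ-shift x = toℕ-fromℕ< (∸-monoˡ-< (toℕ<n (σ ⟨$⟩ʳ embed x)) (t≤val x))
    shift-injective : ∀ {a b} → shift a ≡ shift b → a ≡ b
    shift-injective {a} {b} e = toℕ-injective (trans (sym (toℕ-embed a))
                                  (trans (cong toℕ (val-injective same-val)) (toℕ-embed b)))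
      where
      same-val : val (embed a) ≡ val (embed b)
      same-val = ∸-cancelʳ-≡ (t≤val a) (t≤val b)
                   (trans (sym (toℕ-shift a)) (trans (cong toℕ e) (toℕ-shift b)))

  -- (d) Let D = Φ(σ), X its first and Y its last n steps, c the number of down-steps of X.
  -- Then Y has c up-steps, and t = c.
  module RightHalf (D : List Step) (D≡Φσ : IsPhiOf σ D) where

    X : List Step
    X = take n D

    Y : List Step
    Y = drop n D

    c : ℕ
    c = countD X

    X++Y : X ++ Y ≡ D
    X++Y = take++drop≡id n D

    ups-D : countU D ≡ n
    ups-D = *-cancelˡ-≡ (countU D) n 2 (begin
      countU D + (countU D + 0) ≡⟨ cong (countU D +_) (+-identityʳ (countU D)) ⟩
      countU D + countU D       ≡⟨ cong (countU D +_) (sym (valid-counts (proj₁ (proj₁ D≡Φσ)))) ⟩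
      countU D + countD D       ≡⟨ sym (length-counts D) ⟩
      length D                  ≡⟨ proj₂ (proj₁ D≡Φσ) ⟩
      2 * n                     ∎)
      where open ≡-Reasoning

    downs-D : countD D ≡ n
    downs-D = trans (valid-counts (proj₁ (proj₁ D≡Φσ))) ups-D

    ups-X+c : countU X + c ≡ n
    ups-X+c = trans (sym (length-counts X)) (trans (length-take n D) (m≤n⇒m⊓n≡m n≤length))
      where
      n≤length : n ≤ length D
      n≤length = subst (n ≤_) (sym (proj₂ (proj₁ D≡Φσ))) (m≤m+n n (n + 0))

    ups-Y : countU Y ≡ c
    ups-Y = +-cancelˡ-≡ (countU X) _ _
              (trans (sym (countU-++ X Y)) (trans (cong countU X++Y) (trans ups-D (sym ups-X+c))))

    c≤n : c ≤ n
    c≤n = subst (c ≤_) ups-X+c (m≤n+m c _)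

    upIndex : ℕ → ℕ
    upIndex l = n ∸ suc l

    upIndex+label : ∀ l → l <ℕ n → upIndex l + suc l ≡ n
    upIndex+label l l<n = m∸n+n≡m l<n

    pair-at : ∀ i → (upIndex (toℕ i) , val i) ∈ matching (X ++ Y)
    pair-at i = subst (λ w → _ ∈ matching w) (sym X++Y) (lookupPair-∈ _ _ (proj₂ D≡Φσ i))

    pair-to : ∀ v → (upIndex (pos v) , toℕ v) ∈ matching (X ++ Y)
    pair-to v = subst (λ z → (upIndex (pos v) , z) ∈ matching (X ++ Y)) (val-pos v) (pair-at (σ ⟨$⟩ˡ v))

    -- If t < c, the value t would lie in T: its down-step is in X, so its up-step is in X and
    -- σ⁻¹(t) ≥ c; the up-step labelled t is in Y, so its down-step is in Y and σ(t) ≥ c.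
    c≤t : c ≤ t
    c≤t = ≮⇒≥ t<c-impossible
      where
      t<c-impossible : t <ℕ c → ⊥
      t<c-impossible t<c = t∉T t<n (subst (_<ℕ pos v) (sym tv) (<-≤-trans t<c c≤pos) ,
                                    subst (_<ℕ val v) (sym tv) (<-≤-trans t<c c≤val))
        where
        t<n : t <ℕ n
        t<n = <-≤-trans t<c c≤n
        v : Fin n
        v = fromℕ< t<n
        tv : toℕ v ≡ t
        tv = toℕ-fromℕ< t<n
        c≤pos : c ≤ pos v
        c≤pos with matching-side X Y (pair-to v)
        ... | inj₁ (up∈X , _) = up-index-below (upIndex+label (pos v) (toℕ<n _)) ups-X+c up∈X
        ... | inj₂ (c≤v , _) = ⊥-elim (<-irrefl refl (<-≤-trans t<c (subst (c ≤_) tv c≤v)))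
        c≤val : c ≤ val v
        c≤val with matching-side X Y (pair-at v)
        ... | inj₁ (up∈X , _) = ⊥-elim (<-irrefl refl (<-≤-trans t<c (subst (c ≤_) tv
                                  (up-index-below (upIndex+label (toℕ v) (toℕ<n v)) ups-X+c up∈X))))
        ... | inj₂ (c≤v , _) = c≤v

    -- If c < t, let j = t-1 ∈ T.  Its up-step is in X and its down-step σ(j) ≥ t in Y, so it is
    -- open after X; hence the first down-step of Y (labelled c) is matched with an up-step at
    -- least as late, i.e. σ⁻¹(c) ≤ j < t, against c < t ⇒ σ⁻¹(c) ≥ t.
    t≤c : t ≤ c
    t≤c = ≮⇒≥ c<t-impossible
      where
      c<t-impossible : c <ℕ t → ⊥
      c<t-impossible c<t with max-T (≤-<-trans z≤n c<t)
      ... | j , j+1≡t , j∈T = <-irrefl refl (<-≤-trans pos-w<t (proj₂ (below-t w (subst (_<ℕ t) (sym tw) c<t))))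
        where
        c<n : c <ℕ n
        c<n = <-≤-trans c<t t≤n
        w : Fin n
        w = fromℕ< c<n
        tw : toℕ w ≡ c
        tw = toℕ-fromℕ< c<n
        t≤val-j : t ≤ val j
        t≤val-j = subst (_≤ val j) j+1≡t (T-val-above j j∈T j ≤-refl)
        j-open : upIndex (toℕ j) ∈ stackAfter 0 [] X
        j-open with matching-side X Y (pair-at j)
        ... | inj₁ (_ , val<c) = ⊥-elim (<-irrefl refl (<-≤-trans val<c (≤-trans (<⇒≤ c<t) t≤val-j)))
        ... | inj₂ (_ , inj₁ isOpen) = isOpen
        ... | inj₂ (_ , inj₂ ups-X≤) = ⊥-elim (<-irrefl refl (<-≤-trans up-j<ups-X ups-X≤))
          where
          up-j<ups-X : upIndex (toℕ j) <ℕ countU X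
          up-j<ups-X = up-index-above (upIndex+label (toℕ j) (toℕ<n j)) ups-X+c
                         (s≤s⁻¹ (subst (suc c ≤_) (sym j+1≡t) c<t))
        Y-has-down : 0 <ℕ countD Y
        Y-has-down = +-cancelˡ-< c 0 (countD Y)
          (subst₂ _<ℕ_ (sym (+-identityʳ c))
             (trans (sym downs-D) (trans (cong countD (sym X++Y)) (countD-++ X Y))) c<n)
        later : Σ ℕ λ y → upIndex (toℕ j) ≤ y × (y , c) ∈ matching (X ++ Y)
        later = first-down-matched-later X Y (upIndex (toℕ j)) j-open Y-has-down
        match-w : proj₁ later ≡ upIndex (pos w)
        match-w = matchGo-downUnique 0 0 [] (X ++ Y) (proj₂ (proj₂ later))
                    (subst (λ z → (upIndex (pos w) , z) ∈ matching (X ++ Y)) tw (pair-to w))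
        pos-w<t : pos w <ℕ t
        pos-w<t = subst (pos w <ℕ_) j+1≡t (s≤s (up-index-antitone
                    (upIndex+label (toℕ j) (toℕ<n j)) (upIndex+label (pos w) (toℕ<n _))
                    (subst (upIndex (toℕ j) ≤_) match-w (proj₁ (proj₂ later)))))

    t≡ups-rightHalf : t ≡ countU (rightHalf n D)
    t≡ups-rightHalf = trans (≤-antisym t≤c c≤t) (sym ups-Y)

  -- If j ≥ t and σ(j) > t, some x < j has σ(x) ≤ t.  Since t ∉ T, either σ(t) ≤ t, and then
  -- x = t works (t ≠ j as σ(j) > t), or σ⁻¹(t) ≤ t, and then x = σ⁻¹(t) works (x ≠ j as σ(j) ≠ t).
  small-value-before : ∀ j → t ≤ toℕ j → t <ℕ val j → Σ (Fin n) λ x → toℕ x <ℕ toℕ j × val x ≤ t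
  small-value-before j t≤j t<vj = choose (t <? val tᶠ)
    where
    t<n : t <ℕ n
    t<n = ≤-<-trans t≤j (toℕ<n j)
    tᶠ : Fin n
    tᶠ = fromℕ< t<n
    toℕ-tᶠ : toℕ tᶠ ≡ t
    toℕ-tᶠ = toℕ-fromℕ< t<n
    choose : Dec (t <ℕ val tᶠ) → Σ (Fin n) λ x → toℕ x <ℕ toℕ j × val x ≤ t
    choose (no t≮v) = tᶠ , ≤∧≢⇒< (subst (_≤ toℕ j) (sym toℕ-tᶠ) t≤j) tᶠ≢j , ≮⇒≥ t≮v
      where
      tᶠ≢j : toℕ tᶠ ≢ toℕ j
      tᶠ≢j e = t≮v (subst (λ z → t <ℕ val z) (sym (toℕ-injective e)) t<vj)
    choose (yes t<v) =
      σ ⟨$⟩ˡ tᶠ , ≤∧≢⇒< (≤-trans pos≤t t≤j) pos≢j , ≤-reflexive (trans (val-pos tᶠ) toℕ-tᶠ)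
      where
      pos≤t : pos tᶠ ≤ t
      pos≤t with t <? pos tᶠ
      ... | yes t<pos = ⊥-elim (t∉T t<n (subst (_<ℕ pos tᶠ) (sym toℕ-tᶠ) t<pos ,
                                         subst (_<ℕ val tᶠ) (sym toℕ-tᶠ) t<v))
      ... | no t≮pos = ≮⇒≥ t≮pos
      pos≢j : pos tᶠ ≢ toℕ j
      pos≢j e = <-irrefl (trans (sym (trans (val-pos tᶠ) toℕ-tᶠ)) (cong val (toℕ-injective e))) t<vj

  -- Beyond t, σ has no inversion σ(l) < σ(j) with σ(l) ≥ t: with x from small-value-before,
  -- x < j < l would carry σ(x) < σ(l) < σ(j), a 132.
  increasing-beyond-t : ∀ j l → t ≤ toℕ j → toℕ j <ℕ toℕ l → t ≤ val l → val l <ℕ val j → ⊥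
  increasing-beyond-t j l t≤j j<l t≤vl vl<vj with small-value-before j t≤j (≤-<-trans t≤vl vl<vj)
  ... | x , x<j , vx≤t = avoids x j l x<j j<l (≤∧≢⇒< (≤-trans vx≤t t≤vl) vx≢vl , vl<vj)
    where
    vx≢vl : val x ≢ val l
    vx≢vl e = <-irrefl (cong toℕ (val-injective e)) (<-trans x<j j<l)

  -- (e) In τ = σ^{(t,t)} position t is fixed and the positions before it carry values > t.
  -- A 132 in τ avoiding position t is a 132 in σ; one starting at t is excluded by
  -- increasing-beyond-t; the remaining shapes contradict the value bounds.
  insert-avoids : ∀ (k : Fin (suc n)) → toℕ k ≡ t → Avoids132 (insert k k σ)
  insert-avoids k k≡t i j l i<j j<l (τi<τl , τl<τj) =
    no-pattern (punchIn-view k i) (punchIn-view k j) (punchIn-view k l) i<j j<l τi<τl τl<τj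
    where
    τ : Permutation′ (suc n)
    τ = insert k k σ
    τ-punchIn : ∀ q → toℕ (τ ⟨$⟩ʳ punchIn k q) ≡ toℕ (punchIn k (σ ⟨$⟩ʳ q))
    τ-punchIn q = cong toℕ (insert-punchIn k k σ q)
    τ-k : toℕ (τ ⟨$⟩ʳ k) ≡ toℕ k
    τ-k = cong toℕ (insert-self k σ)
    τ-reflects : ∀ a b → toℕ (τ ⟨$⟩ʳ punchIn k a) <ℕ toℕ (τ ⟨$⟩ʳ punchIn k b) → val a <ℕ val b
    τ-reflects a b lt = punchIn-cancel-< k (σ ⟨$⟩ʳ a) (σ ⟨$⟩ʳ b) (subst₂ _<ℕ_ (τ-punchIn a) (τ-punchIn b) lt)
    front-large : ∀ q → toℕ (punchIn k q) <ℕ toℕ k → toℕ k <ℕ toℕ (τ ⟨$⟩ʳ punchIn k q)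
    front-large q before = subst (toℕ k <ℕ_) (sym (τ-punchIn q))
      (above⇒punchIn-above k (σ ⟨$⟩ʳ q)
        (subst (_≤ val q) (sym k≡t) (proj₁ (below-t q (subst (toℕ q <ℕ_) k≡t (punchIn-below⇒ k q before))))))
    Position : Fin (suc n) → Set
    Position p = (p ≡ k) ⊎ Σ (Fin n) (λ q → p ≡ punchIn k q)
    no-pattern : ∀ {i j l} → Position i → Position j → Position l →
      toℕ i <ℕ toℕ j → toℕ j <ℕ toℕ l →
      toℕ (τ ⟨$⟩ʳ i) <ℕ toℕ (τ ⟨$⟩ʳ l) → toℕ (τ ⟨$⟩ʳ l) <ℕ toℕ (τ ⟨$⟩ʳ j) → ⊥
    no-pattern (inj₁ refl) (inj₁ refl) _ i<j _ _ _ = <-irrefl refl i<j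
    no-pattern (inj₁ refl) (inj₂ _) (inj₁ refl) i<j j<l _ _ = <-asym i<j j<l
    no-pattern (inj₁ refl) (inj₂ (qj , refl)) (inj₂ (ql , refl)) i<j j<l τi<τl τl<τj =
      increasing-beyond-t qj ql (subst (_≤ toℕ qj) k≡t (punchIn-above⇒ k qj i<j)) (punchIn-cancel-< k qj ql j<l)
        (subst (_≤ val ql) k≡t (punchIn-above⇒ k (σ ⟨$⟩ʳ ql) (subst₂ _<ℕ_ τ-k (τ-punchIn ql) τi<τl)))
        (τ-reflects ql qj τl<τj)
    no-pattern {l = l} (inj₂ (qi , refl)) (inj₁ refl) _ i<j _ τi<τl τl<τj =
      <-asym (front-large qi i<j) (<-trans τi<τl (subst (toℕ (τ ⟨$⟩ʳ l) <ℕ_) τ-k τl<τj))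
    no-pattern (inj₂ (qi , refl)) (inj₂ _) (inj₁ refl) i<j j<l τi<τl _ =
      <-asym (front-large qi (<-trans i<j j<l)) (subst (toℕ (τ ⟨$⟩ʳ punchIn k qi) <ℕ_) τ-k τi<τl)
    no-pattern (inj₂ (qi , refl)) (inj₂ (qj , refl)) (inj₂ (ql , refl)) i<j j<l τi<τl τl<τj =
      avoids qi qj ql (punchIn-cancel-< k qi qj i<j) (punchIn-cancel-< k qj ql j<l)
        (τ-reflects qi ql τi<τl , τ-reflects ql qj τl<τj)

proposition3p1 : (n : ℕ) (σ : Permutation′ n) → Avoids132 σ →
    ((p : 0 <ℕ n) → ((∀ (i : Fin n) → ¬ InT σ i) ⇔ (σ ⟨$⟩ʳ fromℕ< p ≡ fromℕ< p)))
    × (∀ (j : Fin n) → InT σ j → ∀ (i : Fin n) → i ≤ᶠ j → InT σ i)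
    × (2 * cardT σ ≤ n)
    × (∀ (D : List Step) → IsPhiOf σ D → cardT σ ≡ countU (rightHalf n D))
    × (∀ (k : Fin (suc n)) → toℕ k ≡ cardT σ → Avoids132 (insert k k σ))
proposition3p1 n σ avoids =
    T-empty⇔fixes-first
  , T-downClosed
  , twice-t≤n
  , (λ D D≡Φσ → RightHalf.t≡ups-rightHalf D D≡Φσ)
  , insert-avoids
  where open Avoiding σ avoids
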